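{- Let $\ell\geq 2$ and $n\ge 2$ be integers. Define $s_0=0$, $s_1=1$ and $s_{i+1}=\ell s_i-s_{i-1}$ for $i\ge 1$, and let ${\boldsymbol s}=(s_1,\ldots,s_n)$. Let \[ L_n^\ell=\left\{\lambda\in\mathbb{Z}^n : 0\leq \frac{\lambda_1}{s_1}\leq \frac{\lambda_2}{s_2}\leq\cdots\leq\frac{\lambda_n}{s_n}\right\}, \] the set of lattice points of the cone $\mathcal{C}_n^\ell=\{\lambda\in\mathbb{R}^n: 0\le\lambda_1/s_1\le\cdots\le\lambda_n/s_n\}$. Then the Hilbert basis of $\mathcal{C}_n^\ell$ is \[ \mathcal{H}_n^\ell=\bigcup_{i=0}^{n}\left\{\lambda\in L_n^\ell : \lambda_{n-1}=s_i,\ \lambda_n=s_{i+1}\right\}. \]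
   Context: For a pointed rational cone $C\subseteq\mathbb{R}^n$, the Hilbert basis of $C$ is the unique minimal subset of $C\cap\mathbb{Z}^n$ generating the semigroup $C\cap\mathbb{Z}^n$ under addition with nonnegative integer coefficients. The terms $s_i$ with $i>n$ are defined by the same recurrence. -}

module Defs where

open import Data.Nat using (ℕ; zero; suc; _≤_; _<_; _∸_)
open import Data.Integer using (ℤ; +_; _+_; _-_; _*_) renaming (_≤_ to _≤ℤ_)
open import Data.Vec using (Vec; []; _∷_; replicate; zipWith)
open import Data.Product using (Σ; _×_; ∃-syntax)
open import Relation.Binary.PropositionalEquality using (_≡_)

s : ℕ → ℕ → ℤ
s ℓ zero = + 0
s ℓ (suc zero) = + 1
s ℓ (suc (suc i)) = (+ ℓ) * s ℓ (suc i) - s ℓ i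

-- 1-based entry of a vector: entry λ k = λ_k for 1 ≤ k ≤ n (0 outside the range,
-- never used outside the range below).
entry : ∀ {n} → Vec ℤ n → ℕ → ℤ
entry [] _ = + 0
entry (x ∷ xs) zero = + 0
entry (x ∷ xs) (suc zero) = x
entry (x ∷ xs) (suc (suc k)) = entry xs (suc k)

-- Since s_i > 0 for i ≥ 1 (ℓ ≥ 2), λ_i/s_i ≤ λ_{i+1}/s_{i+1} is written
-- cross-multiplied as λ_i * s_{i+1} ≤ λ_{i+1} * s_i, and 0 ≤ λ_1/s_1 as 0 ≤ λ_1.
L : (n ℓ : ℕ) → Vec ℤ n → Set
L n ℓ λv = (+ 0 ≤ℤ entry λv 1)
  × (∀ i → 1 ≤ i → i < n →
       entry λv i * s ℓ (suc i) ≤ℤ entry λv (suc i) * s ℓ i)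

H : (n ℓ : ℕ) → Vec ℤ n → Set
H n ℓ λv = L n ℓ λv × ∃[ i ] (i ≤ n × entry λv (n ∸ 1) ≡ s ℓ i × entry λv n ≡ s ℓ (suc i))

data Generated {n : ℕ} (S : Vec ℤ n → Set) : Vec ℤ n → Set where
  gen-zero : Generated S (replicate n (+ 0))
  gen-add  : ∀ {h μ} → S h → Generated S μ → Generated S (zipWith _+_ h μ)

_⊆_ : ∀ {n} → (Vec ℤ n → Set) → (Vec ℤ n → Set) → Set
A ⊆ B = ∀ v → A v → B v

Generates : ∀ {n} → (Vec ℤ n → Set) → (Vec ℤ n → Set) → Set
Generates P B = (B ⊆ P) × (P ⊆ Generated B)

-- B is the Hilbert basis of the semigroup P: a minimal (w.r.t. inclusion)
-- generating subset of P (such a set is unique for pointed rational cones).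
IsHilbertBasis : ∀ {n} → (Vec ℤ n → Set) → (Vec ℤ n → Set) → Set₁
IsHilbertBasis P B = Generates P B × (∀ B′ → B′ ⊆ B → Generates P B′ → B ⊆ B′)

module Submission where

-- For ℓ ≥ 2 the sequence s is increasing and satisfies the Casoratian identity
--   s_{a+1} s_{a+c} - s_a s_{a+c+1} = s_c,
-- so consecutive pairs (s_k, s_{k+1}), (s_{k+1}, s_{k+2}) form a basis of ℤ².
-- Writing plane lattice vectors in these bases yields two facts: a Farey
-- property (slope-bound: a vector of slope between s_i/s_{i+1} and
-- s_N/s_{N+1} has second entry ≥ s_{i+1}) and a "no lattice point between"
-- property (escape).
--   Minimality: if h ∈ H is b + μ with b ∈ H and μ in the cone, the Farey
-- property on the last two entries forces μ = 0; hence a generating subset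
-- of H contains all of H.
--   Generation: a nonzero λ is split as λ = min(λ, p) + (λ - min(λ, p)),
-- where p = (s_{k-c})_k is the largest shifted profile fitting below the last
-- two entries of λ.  Then min(λ, p) ∈ H, escape keeps the remainder in the
-- cone, and its last entry is smaller, so induction finishes.

open import Data.Nat using (ℕ)
open import Defs

module IntegerArithmetic where

  open import Data.Integer using (0ℤ; 1ℤ; _+_; _-_; _*_; _≤_; _<_; _≤?_; nonNegative)
  open import Data.Integer.Properties
  open import Data.Integer.Tactic.RingSolver using (solve-∀)
  open import Data.Empty using (⊥; ⊥-elim)
  open import Relation.Binary.PropositionalEquality using (_≡_; sym; trans; cong; subst)
  open import Relation.Nullary using (yes; no)

  0≤+ : ∀ {a b} → 0ℤ ≤ a → 0ℤ ≤ b → 0ℤ ≤ a + b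
  0≤+ = +-mono-≤

  0≤* : ∀ {a b} → 0ℤ ≤ a → 0ℤ ≤ b → 0ℤ ≤ a * b
  0≤* {a} {b} 0≤a 0≤b = subst (_≤ a * b) (*-zeroʳ a) (*-monoˡ-≤-nonNeg a {{nonNegative 0≤a}} 0≤b)

  ≤-scale : ∀ {a b c} → 0ℤ ≤ c → a ≤ b → a * c ≤ b * c
  ≤-scale {c = c} 0≤c = *-monoʳ-≤-nonNeg c {{nonNegative 0≤c}}

  ≤-by : ∀ {a b} c → b - a ≡ c → 0ℤ ≤ c → a ≤ b
  ≤-by c b-a≡c 0≤c = 0≤i-j⇒j≤i (subst (0ℤ ≤_) (sym b-a≡c) 0≤c)

  <-by : ∀ {a b} c → b - a - 1ℤ ≡ c → 0ℤ ≤ c → a < b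
  <-by {a} {b} c eq 0≤c = suc[i]≤j⇒i<j (≤-by c (trans (shift a b) eq) 0≤c)
    where
    shift : ∀ a b → b - (1ℤ + a) ≡ b - a - 1ℤ
    shift = solve-∀

  <⇒0≤ : ∀ {a b} → a < b → 0ℤ ≤ b - a - 1ℤ
  <⇒0≤ {a} {b} a<b = subst (0ℤ ≤_) (shift a b) (i≤j⇒0≤j-i (i<j⇒suc[i]≤j a<b))
    where
    shift : ∀ a b → b - (1ℤ + a) ≡ b - a - 1ℤ
    shift = solve-∀

  <-by-pos : ∀ {a b} c → b - a ≡ c → 0ℤ < c → a < b
  <-by-pos {a} {b} c b-a≡c 0<c =
    <-by _ (trans (shift a b) (cong (λ z → z - 0ℤ - 1ℤ) b-a≡c)) (<⇒0≤ 0<c)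
    where
    shift : ∀ a b → b - a - 1ℤ ≡ (b - a) - 0ℤ - 1ℤ
    shift = solve-∀

  positive-factor : ∀ {t A} → 0ℤ ≤ A → 0ℤ < t * A → 0ℤ < t
  positive-factor {t} {A} 0≤A 0<tA with t ≤? 0ℤ
  ... | no t≰0  = ≰⇒> t≰0
  ... | yes t≤0 = ⊥-elim (≤⇒≯ (*-monoʳ-≤-nonNeg A {{nonNegative 0≤A}} t≤0) 0<tA)

  -- Let 0 ≤ A < B and 0 ≤ C′ < C.  No integers γ, δ make x = γA + δB lie
  -- strictly between A and B while D = γC + δC′ lies in [0, C): if δ ≤ 0,
  -- then A < x forces γ + δ ≥ 2, hence D ≥ C; if δ ≥ 1, then x < B forces
  -- γ + δ ≤ 0, hence D < 0.
  no-point-between : ∀ {A B C C′ γ δ} → 0ℤ ≤ A → A < B → 0ℤ ≤ C′ → C′ < C →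
                     A < γ * A + δ * B → γ * A + δ * B < B →
                     0ℤ ≤ γ * C + δ * C′ → γ * C + δ * C′ < C → ⊥
  no-point-between {A} {B} {C} {C′} {γ} {δ} 0≤A A<B 0≤C′ C′<C A<x x<B 0≤D D<C with δ ≤? 0ℤ
  ... | yes δ≤0 = <⇒≱ D<C C≤D
    where
    0≤-δ : 0ℤ ≤ 0ℤ - δ
    0≤-δ = i≤j⇒0≤j-i δ≤0
    0<γ+δ-1 : 0ℤ < γ + δ - 1ℤ
    0<γ+δ-1 = positive-factor 0≤A (<-by _ (excess A B γ δ)
                (0≤+ (<⇒0≤ A<x) (0≤* 0≤-δ (i≤j⇒0≤j-i (<⇒≤ A<B)))))
      where
      excess : ∀ A B γ δ → (γ + δ - 1ℤ) * A - 0ℤ - 1ℤ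
                           ≡ (γ * A + δ * B - A - 1ℤ) + (0ℤ - δ) * (B - A)
      excess = solve-∀
    C≤D : C ≤ γ * C + δ * C′
    C≤D = ≤-by _ (difference C C′ γ δ)
            (0≤+ (0≤* (<⇒≤ 0<γ+δ-1) (≤-trans 0≤C′ (<⇒≤ C′<C))) (0≤* 0≤-δ (i≤j⇒0≤j-i (<⇒≤ C′<C))))
      where
      difference : ∀ C C′ γ δ → γ * C + δ * C′ - C ≡ (γ + δ - 1ℤ) * C + (0ℤ - δ) * (C - C′)
      difference = solve-∀
  ... | no δ≰0 = <⇒≱ D<0 0≤D
    where
    0≤δ-1 : 0ℤ ≤ δ - 0ℤ - 1ℤ
    0≤δ-1 = <⇒0≤ (≰⇒> δ≰0)
    0<1-γ-δ : 0ℤ < 1ℤ - γ - δ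
    0<1-γ-δ = positive-factor 0≤A (<-by _ (excess A B γ δ)
                (0≤+ (<⇒0≤ x<B) (0≤* 0≤δ-1 (i≤j⇒0≤j-i (<⇒≤ A<B)))))
      where
      excess : ∀ A B γ δ → (1ℤ - γ - δ) * A - 0ℤ - 1ℤ
                           ≡ (B - (γ * A + δ * B) - 1ℤ) + (δ - 0ℤ - 1ℤ) * (B - A)
      excess = solve-∀
    D<0 : γ * C + δ * C′ < 0ℤ
    D<0 = <-by _ (difference C C′ γ δ)
            (0≤+ (0≤+ (0≤* (<⇒0≤ 0<1-γ-δ) (≤-trans 0≤C′ (<⇒≤ C′<C)))
                      (0≤* 0≤δ-1 (i≤j⇒0≤j-i (<⇒≤ C′<C))))
                 (<⇒0≤ C′<C))
      where
      difference : ∀ C C′ γ δ → 0ℤ - (γ * C + δ * C′) - 1ℤ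
                   ≡ (1ℤ - γ - δ - 0ℤ - 1ℤ) * C + (δ - 0ℤ - 1ℤ) * (C - C′) + (C - C′ - 1ℤ)
      difference = solve-∀

module Identities (ℓ : ℕ) where

  open import Data.Nat as ℕ using (zero; suc)
  open import Data.Nat.Properties as ℕP using ()
  open import Data.Integer using (+_; 1ℤ; _-_; _*_)
  open import Data.Integer.Tactic.RingSolver using (solve-∀)
  open import Relation.Binary.PropositionalEquality using (_≡_; trans; subst)

  casoratian : ∀ a c → s ℓ (suc a) * s ℓ (a ℕ.+ c) - s ℓ a * s ℓ (suc (a ℕ.+ c)) ≡ s ℓ c
  casoratian zero c = base (s ℓ c) (s ℓ (suc c))
    where
    base : ∀ x y → 1ℤ * x - + 0 * y ≡ x
    base = solve-∀
  casoratian (suc a) c =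
    trans (step (+ ℓ) (s ℓ (suc a)) (s ℓ a) (s ℓ (suc (a ℕ.+ c))) (s ℓ (a ℕ.+ c))) (casoratian a c)
    where
    step : ∀ L u v p q → (L * u - v) * p - u * (L * p - q) ≡ u * q - v * p
    step = solve-∀

  unimodular : ∀ k → s ℓ (suc k) * s ℓ (suc k) - s ℓ k * s ℓ (suc (suc k)) ≡ 1ℤ
  unimodular k = subst (λ j → s ℓ (suc k) * s ℓ j - s ℓ k * s ℓ (suc j) ≡ 1ℤ)
                       (ℕP.+-comm k 1) (casoratian k 1)

module Growth (ℓ : ℕ) (2≤ℓ : 2 Data.Nat.≤ ℓ) where

  open import Data.Nat as ℕ using (zero; suc; z≤n; s≤s)
  open import Data.Nat.Properties as ℕP using ()
  open import Data.Integer using (+_; +≤+; +<+; 0ℤ; 1ℤ; _+_; _-_; _*_; _≤_; _<_)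
  open import Data.Integer.Properties
  open import Data.Integer.Tactic.RingSolver using (solve-∀)
  open import Data.Product using (_×_; _,_; proj₁; proj₂)
  open import Relation.Binary.PropositionalEquality using (_≡_; subst)
  open IntegerArithmetic
  open Identities ℓ

  growth : ∀ k → 0ℤ ≤ s ℓ k × s ℓ k < s ℓ (suc k)
  growth zero = +≤+ z≤n , +<+ (s≤s z≤n)
  growth (suc k) with growth k
  ... | 0≤sk , sk<sk+1 =
    0≤sk+1 , <-by _ (step (+ ℓ) (s ℓ (suc k)) (s ℓ k)) (0≤+ (0≤* 0≤ℓ-2 0≤sk+1) (<⇒0≤ sk<sk+1))
    where
    0≤sk+1 : 0ℤ ≤ s ℓ (suc k)
    0≤sk+1 = ≤-trans 0≤sk (<⇒≤ sk<sk+1)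
    0≤ℓ-2 : 0ℤ ≤ + ℓ - + 2
    0≤ℓ-2 = i≤j⇒0≤j-i (+≤+ 2≤ℓ)
    step : ∀ L x y → (L * x - y) - x - 1ℤ ≡ (L - + 2) * x + (x - y - 1ℤ)
    step = solve-∀

  s-nonneg : ∀ k → 0ℤ ≤ s ℓ k
  s-nonneg k = proj₁ (growth k)

  s-increasing : ∀ k → s ℓ k < s ℓ (suc k)
  s-increasing k = proj₂ (growth k)

  s-mono-≤ : ∀ {i j} → i ℕ.≤ j → s ℓ i ≤ s ℓ j
  s-mono-≤ {i} {j} i≤j = subst (λ k → s ℓ i ≤ s ℓ k) (ℕP.m∸n+n≡m i≤j) (shifted (j ℕ.∸ i))
    where
    shifted : ∀ d → s ℓ i ≤ s ℓ (d ℕ.+ i)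
    shifted zero    = ≤-refl
    shifted (suc d) = ≤-trans (shifted d) (<⇒≤ (s-increasing (d ℕ.+ i)))

  s-mono-< : ∀ {i j} → i ℕ.< j → s ℓ i < s ℓ j
  s-mono-< {i} i<j = <-≤-trans (s-increasing i) (s-mono-≤ i<j)

  s-pos : ∀ k → 0ℤ < s ℓ (suc k)
  s-pos k = s-mono-< {0} {suc k} (s≤s z≤n)

  ratio-increasing : ∀ {N i} → N ℕ.< i → s ℓ N * s ℓ (suc i) < s ℓ (suc N) * s ℓ i
  ratio-increasing {N} {i} N<i = <-by-pos _ difference (s-mono-< (ℕP.m<n⇒0<n∸m N<i))
    where
    difference : s ℓ (suc N) * s ℓ i - s ℓ N * s ℓ (suc i) ≡ s ℓ (i ℕ.∸ N)
    difference = subst (λ j → s ℓ (suc N) * s ℓ j - s ℓ N * s ℓ (suc j) ≡ s ℓ (i ℕ.∸ N))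
                       (ℕP.m+[n∸m]≡n (ℕP.<⇒≤ N<i)) (casoratian N (i ℕ.∸ N))

module UnimodularBasis (ℓ : ℕ) (2≤ℓ : 2 Data.Nat.≤ ℓ) where

  open import Data.Nat as ℕ using (zero; suc)
  open import Data.Nat.Properties as ℕP using ()
  open import Data.Integer using (ℤ; 0ℤ; 1ℤ; _+_; _-_; _*_; _≤_; _<_; _≤?_)
  open import Data.Integer.Properties
  open import Data.Integer.Tactic.RingSolver using (solve-∀)
  open import Data.Empty using (⊥-elim)
  open import Data.Sum using (_⊎_; inj₁; inj₂)
  open import Relation.Binary.PropositionalEquality
    using (_≡_; refl; sym; trans; cong; cong₂; subst; module ≡-Reasoning)
  open import Relation.Nullary using (yes; no)
  open IntegerArithmetic
  open Identities ℓ
  open Growth ℓ 2≤ℓ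

  -- (x, y) = coord-u k x y · u_k + coord-v k x y · v_k  (Cramer's rule, det = 1).
  coord-u : ℕ → ℤ → ℤ → ℤ
  coord-u k x y = y * s ℓ (suc k) - x * s ℓ (suc (suc k))

  coord-v : ℕ → ℤ → ℤ → ℤ
  coord-v k x y = x * s ℓ (suc k) - y * s ℓ k

  first-coordinate : ∀ k x y → x ≡ coord-u k x y * s ℓ k + coord-v k x y * s ℓ (suc k)
  first-coordinate k x y = sym (begin
    coord-u k x y * s ℓ k + coord-v k x y * s ℓ (suc k)
      ≡⟨ cramer x y (s ℓ k) (s ℓ (suc k)) (s ℓ (suc (suc k))) ⟩
    x * (s ℓ (suc k) * s ℓ (suc k) - s ℓ k * s ℓ (suc (suc k)))
      ≡⟨ cong (x *_) (unimodular k) ⟩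
    x * 1ℤ
      ≡⟨ *-identityʳ x ⟩
    x ∎)
    where
    open ≡-Reasoning
    cramer : ∀ x y a b c → (y * b - x * c) * a + (x * b - y * a) * b ≡ x * (b * b - a * c)
    cramer = solve-∀

  second-coordinate : ∀ k x y → y ≡ coord-u k x y * s ℓ (suc k) + coord-v k x y * s ℓ (suc (suc k))
  second-coordinate k x y = sym (begin
    coord-u k x y * s ℓ (suc k) + coord-v k x y * s ℓ (suc (suc k))
      ≡⟨ cramer x y (s ℓ k) (s ℓ (suc k)) (s ℓ (suc (suc k))) ⟩
    y * (s ℓ (suc k) * s ℓ (suc k) - s ℓ k * s ℓ (suc (suc k)))
      ≡⟨ cong (y *_) (unimodular k) ⟩
    y * 1ℤ
      ≡⟨ *-identityʳ y ⟩
    y ∎)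
    where
    open ≡-Reasoning
    cramer : ∀ x y a b c → (y * b - x * c) * b + (x * b - y * a) * c ≡ y * (b * b - a * c)
    cramer = solve-∀

  denominator-bound : ∀ k x y → 0ℤ ≤ coord-v k x y → 0ℤ < coord-u k x y → s ℓ (suc k) ≤ y
  denominator-bound k x y 0≤v 0<u =
    ≤-by _ (trans (cong (_- s ℓ (suc k)) (second-coordinate k x y))
                  (regroup (coord-u k x y) (coord-v k x y) (s ℓ (suc k)) (s ℓ (suc (suc k)))))
         (0≤+ (0≤* (<⇒0≤ 0<u) (s-nonneg (suc k))) (0≤* 0≤v (s-nonneg (suc (suc k)))))
    where
    regroup : ∀ u v b c → (u * b + v * c) - b ≡ (u - 0ℤ - 1ℤ) * b + v * c
    regroup = solve-∀

  farey-step : ∀ k x y → y * s ℓ k ≤ x * s ℓ (suc k) →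
               s ℓ (suc k) ≤ y ⊎ y * s ℓ (suc k) ≤ x * s ℓ (suc (suc k))
  farey-step k x y lower with coord-u k x y ≤? 0ℤ
  ... | yes u≤0 = inj₂ (≤-by _ (negate x y (s ℓ (suc k)) (s ℓ (suc (suc k)))) (i≤j⇒0≤j-i u≤0))
    where
    negate : ∀ x y b c → x * c - y * b ≡ 0ℤ - (y * b - x * c)
    negate = solve-∀
  ... | no u≰0  = inj₁ (denominator-bound k x y (i≤j⇒0≤j-i lower) (≰⇒> u≰0))

  farey-end : ∀ k x y → 0ℤ < y → y * s ℓ k ≤ x * s ℓ (suc k) → x * s ℓ (suc k) ≤ y * s ℓ k →
              s ℓ (suc k) ≤ y
  farey-end k x y 0<y lower upper =
    denominator-bound k x y (i≤j⇒0≤j-i lower) (positive-factor (s-nonneg (suc k)) 0<u·s)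
    where
    u v : ℤ
    u = coord-u k x y
    v = coord-v k x y
    regroup : ∀ u v b c → u * b - 0ℤ - 1ℤ ≡ ((u * b + v * c) - 0ℤ - 1ℤ) + (0ℤ - v) * c
    regroup = solve-∀
    0<u·s : 0ℤ < u * s ℓ (suc k)
    0<u·s = <-by _ (trans (regroup u v (s ℓ (suc k)) (s ℓ (suc (suc k))))
                          (cong (λ z → (z - 0ℤ - 1ℤ) + (0ℤ - v) * s ℓ (suc (suc k)))
                                (sym (second-coordinate k x y))))
                   (0≤+ (<⇒0≤ 0<y) (0≤* (i≤j⇒0≤j-i (i≤j⇒i-j≤0 upper)) (s-nonneg (suc (suc k)))))

  farey-chain : ∀ d j x y → 0ℤ < y → y * s ℓ j ≤ x * s ℓ (suc j) →
                x * s ℓ (suc (d ℕ.+ j)) ≤ y * s ℓ (d ℕ.+ j) → s ℓ (suc j) ≤ y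
  farey-chain zero    j x y 0<y lower upper = farey-end j x y 0<y lower upper
  farey-chain (suc d) j x y 0<y lower upper with farey-step j x y lower
  ... | inj₁ bound = bound
  ... | inj₂ lower′ = ≤-trans (<⇒≤ (s-increasing (suc j)))
                              (farey-chain d (suc j) x y 0<y lower′ upper′)
    where
    upper′ : x * s ℓ (suc (d ℕ.+ suc j)) ≤ y * s ℓ (d ℕ.+ suc j)
    upper′ = subst (λ i → x * s ℓ (suc i) ≤ y * s ℓ i) (sym (ℕP.+-suc d j)) upper

  slope-bound : ∀ {N i} → i ℕ.≤ N → ∀ x y → 0ℤ < y →
                y * s ℓ i ≤ x * s ℓ (suc i) → x * s ℓ (suc N) ≤ y * s ℓ N → s ℓ (suc i) ≤ y
  slope-bound {N} {i} i≤N x y 0<y lower upper =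
    farey-chain (N ℕ.∸ i) i x y 0<y lower
      (subst (λ K → x * s ℓ (suc K) ≤ y * s ℓ K) (sym (ℕP.m∸n+n≡m i≤N)) upper)

  functional-in-coordinates : ∀ a c x y →
    y * s ℓ (a ℕ.+ suc c) - x * s ℓ (suc (a ℕ.+ suc c))
      ≡ coord-u a x y * s ℓ (suc c) + coord-v a x y * s ℓ c
  functional-in-coordinates a c x y = begin
    y * P - x * Q
      ≡⟨ cong₂ (λ X Y → Y * P - X * Q) (first-coordinate a x y) (second-coordinate a x y) ⟩
    (γ * s ℓ (suc a) + δ * s ℓ (suc (suc a))) * P - (γ * s ℓ a + δ * s ℓ (suc a)) * Q
      ≡⟨ regroup γ δ (s ℓ a) (s ℓ (suc a)) (s ℓ (suc (suc a))) P Q ⟩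
    γ * (s ℓ (suc a) * P - s ℓ a * Q) + δ * (s ℓ (suc (suc a)) * P - s ℓ (suc a) * Q)
      ≡⟨ cong₂ (λ U V → γ * U + δ * V) (casoratian a (suc c)) value-on-v ⟩
    γ * s ℓ (suc c) + δ * s ℓ c ∎
    where
    open ≡-Reasoning
    P Q γ δ : ℤ
    P = s ℓ (a ℕ.+ suc c)
    Q = s ℓ (suc (a ℕ.+ suc c))
    γ = coord-u a x y
    δ = coord-v a x y
    regroup : ∀ γ δ a₀ a₁ a₂ P Q → (γ * a₁ + δ * a₂) * P - (γ * a₀ + δ * a₁) * Q
                                  ≡ γ * (a₁ * P - a₀ * Q) + δ * (a₂ * P - a₁ * Q)
    regroup = solve-∀
    value-on-v : s ℓ (suc (suc a)) * P - s ℓ (suc a) * Q ≡ s ℓ c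
    value-on-v = subst (λ K → s ℓ (suc (suc a)) * s ℓ K - s ℓ (suc a) * s ℓ (suc K) ≡ s ℓ c)
                       (sym (ℕP.+-suc a c)) (casoratian (suc a) c)

  -- An integer vector (x, y) with s_a < x and 0 ≤ D(x, y) < s_{c+1} already has
  -- x ≥ s_{a+1}: otherwise its coordinates (γ, δ) contradict no-point-between.
  escape : ∀ a c x y → s ℓ a < x →
           0ℤ ≤ y * s ℓ (a ℕ.+ suc c) - x * s ℓ (suc (a ℕ.+ suc c)) →
           y * s ℓ (a ℕ.+ suc c) - x * s ℓ (suc (a ℕ.+ suc c)) < s ℓ (suc c) →
           s ℓ (suc a) ≤ x
  escape a c x y sa<x 0≤D D<sc with s ℓ (suc a) ≤? x
  ... | yes bound = bound
  ... | no  x≱    = ⊥-elim (no-point-between {γ = coord-u a x y} {δ = coord-v a x y}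
                      (s-nonneg a) (s-increasing a) (s-nonneg c) (s-increasing c)
                      (subst (s ℓ a <_) (first-coordinate a x y) sa<x)
                      (subst (_< s ℓ (suc a)) (first-coordinate a x y) (≰⇒> x≱))
                      (subst (0ℤ ≤_) (functional-in-coordinates a c x y) 0≤D)
                      (subst (_< s ℓ (suc c)) (functional-in-coordinates a c x y) D<sc))

  escape-at : ∀ e k x y → suc e ℕ.≤ k → s ℓ (k ℕ.∸ suc e) < x →
              0ℤ ≤ y * s ℓ k - x * s ℓ (suc k) → y * s ℓ k - x * s ℓ (suc k) < s ℓ (suc e) →
              s ℓ (k ℕ.∸ e) ≤ x
  escape-at e k x y e<k = at-offset (k ℕ.∸ suc e) k (sym (ℕP.m∸n+n≡m e<k))
    where
    offset : ∀ a → a ℕ.+ suc e ℕ.∸ e ≡ suc a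
    offset a = trans (cong (ℕ._∸ e) (ℕP.+-suc a e)) (ℕP.m+n∸n≡m (suc a) e)
    at-offset : ∀ a K → K ≡ a ℕ.+ suc e → s ℓ (K ℕ.∸ suc e) < x →
                0ℤ ≤ y * s ℓ K - x * s ℓ (suc K) → y * s ℓ K - x * s ℓ (suc K) < s ℓ (suc e) →
                s ℓ (K ℕ.∸ e) ≤ x
    at-offset a .(a ℕ.+ suc e) refl rewrite ℕP.m+n∸n≡m a (suc e) = λ sₐ<x 0≤D D<s →
      subst (λ i → s ℓ i ≤ x) (sym (offset a)) (escape a e x y sₐ<x 0≤D D<s)

module Vectors where

  open import Data.Nat as ℕ using (zero; suc; z≤n; s≤s)
  open import Data.Integer using (ℤ; 0ℤ; _+_)
  open import Data.Vec using (Vec; []; _∷_; replicate; zipWith)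
  open import Relation.Binary.PropositionalEquality using (_≡_; refl; cong₂)

  tabulate₁ : (ℕ → ℤ) → (n : ℕ) → Vec ℤ n
  tabulate₁ f zero    = []
  tabulate₁ f (suc n) = f 1 ∷ tabulate₁ (λ k → f (suc k)) n

  entry-tabulate₁ : ∀ f n k → 1 ℕ.≤ k → k ℕ.≤ n → entry (tabulate₁ f n) k ≡ f k
  entry-tabulate₁ f (suc n) (suc zero)    _ _         = refl
  entry-tabulate₁ f (suc n) (suc (suc k)) _ (s≤s k≤n) =
    entry-tabulate₁ (λ j → f (suc j)) n (suc k) (s≤s z≤n) k≤n

  entries-determine : ∀ {n} (u v : Vec ℤ n) →
                      (∀ k → 1 ℕ.≤ k → k ℕ.≤ n → entry u k ≡ entry v k) → u ≡ v
  entries-determine []       []       _    = refl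
  entries-determine (x ∷ u) (y ∷ v) same =
    cong₂ _∷_ (same 1 (s≤s z≤n) (s≤s z≤n))
              (entries-determine u v λ { (suc k) _ k≤n → same (suc (suc k)) (s≤s z≤n) (s≤s k≤n) })

  entry-zipWith : ∀ {n} (u v : Vec ℤ n) k → entry (zipWith _+_ u v) k ≡ entry u k + entry v k
  entry-zipWith []       []       k             = refl
  entry-zipWith (x ∷ u) (y ∷ v) zero          = refl
  entry-zipWith (x ∷ u) (y ∷ v) (suc zero)    = refl
  entry-zipWith (x ∷ u) (y ∷ v) (suc (suc k)) = entry-zipWith u v (suc k)

  entry-replicate : ∀ n k → entry (replicate n 0ℤ) k ≡ 0ℤ
  entry-replicate zero    k             = refl
  entry-replicate (suc n) zero          = refl
  entry-replicate (suc n) (suc zero)    = refl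
  entry-replicate (suc n) (suc (suc k)) = entry-replicate n (suc k)

module Cone (ℓ : ℕ) (2≤ℓ : 2 Data.Nat.≤ ℓ) where

  open import Data.Nat as ℕ using (zero; suc; z≤n; s≤s)
  open import Data.Nat.Properties as ℕP using ()
  open import Data.Integer using (ℤ; 0ℤ; _+_; _-_; _*_; _⊓_; _≤_; _<_; _≤?_; positive)
  open import Data.Integer.Properties
  open import Data.Integer.Tactic.RingSolver using (solve-∀)
  open import Data.Vec using (Vec; replicate; zipWith)
  open import Data.Product using (_,_)
  open import Data.Sum using (inj₁; inj₂)
  open import Relation.Binary.PropositionalEquality using (_≡_; refl; sym; trans; subst; subst₂)
  open import Relation.Nullary using (yes; no)
  open IntegerArithmetic
  open Growth ℓ 2≤ℓ
  open Vectors

  Ordered : ℕ → (ℕ → ℤ) → Set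
  Ordered n f = ∀ k → 1 ℕ.≤ k → k ℕ.< n → f k * s ℓ (suc k) ≤ f (suc k) * s ℓ k

  gap : (ℕ → ℤ) → ℕ → ℤ
  gap f k = f (suc k) * s ℓ k - f k * s ℓ (suc k)

  ordered-cong : ∀ {n f g} → (∀ k → 1 ℕ.≤ k → k ℕ.≤ n → f k ≡ g k) → Ordered n f → Ordered n g
  ordered-cong {f = f} {g} f≗g f-ordered k 1≤k k<n =
    subst₂ (λ a b → a * s ℓ (suc k) ≤ b * s ℓ k)
           (f≗g k 1≤k (ℕP.<⇒≤ k<n)) (f≗g (suc k) (s≤s z≤n) k<n) (f-ordered k 1≤k k<n)

  L-tabulate₁ : ∀ {n} f → 1 ℕ.≤ n → 0ℤ ≤ f 1 → Ordered n f → L n ℓ (tabulate₁ f n)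
  L-tabulate₁ {n} f 1≤n 0≤f₁ f-ordered =
    subst (0ℤ ≤_) (sym (entry-tabulate₁ f n 1 (s≤s z≤n) 1≤n)) 0≤f₁ ,
    ordered-cong (λ k 1≤k k≤n → sym (entry-tabulate₁ f n k 1≤k k≤n)) f-ordered

  L-nonneg : ∀ {n} (v : Vec ℤ n) → L n ℓ v → ∀ k → 1 ℕ.≤ k → k ℕ.≤ n → 0ℤ ≤ entry v k
  L-nonneg v (0≤v₁ , _)         (suc zero)    _ _   = 0≤v₁
  L-nonneg v v∈L@(_ , ordered) (suc (suc k)) _ k<n =
    *-cancelʳ-≤-pos 0ℤ (entry v (suc (suc k))) (s ℓ (suc k)) {{positive (s-pos k)}}
      (≤-trans (0≤* (L-nonneg v v∈L (suc k) (s≤s z≤n) (ℕP.<⇒≤ k<n)) (s-nonneg (suc (suc k))))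
               (ordered (suc k) (s≤s z≤n) k<n))

  L-vanishing : ∀ {n} (v : Vec ℤ n) → L n ℓ v → entry v n ≡ 0ℤ → v ≡ replicate n 0ℤ
  L-vanishing {n} v v∈L@(_ , ordered) vₙ≡0 = entries-determine v (replicate n 0ℤ) λ k 1≤k k≤n →
    trans (below (n ℕ.∸ k) k 1≤k (ℕP.m∸n+n≡m k≤n)) (sym (entry-replicate n k))
    where
    below : ∀ d k → 1 ℕ.≤ k → d ℕ.+ k ≡ n → entry v k ≡ 0ℤ
    below zero    k _   refl = vₙ≡0
    below (suc d) k 1≤k d+k<n =
      ≤-antisym (*-cancelʳ-≤-pos (entry v k) 0ℤ (s ℓ (suc k)) {{positive (s-pos k)}}
                   (subst (λ z → entry v k * s ℓ (suc k) ≤ z * s ℓ k) next≡0 (ordered k 1≤k k<n)))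
                (L-nonneg v v∈L k 1≤k (ℕP.<⇒≤ k<n))
      where
      k<n : k ℕ.< n
      k<n = subst (k ℕ.<_) d+k<n (ℕP.m<n+m k (s≤s z≤n))
      next≡0 : entry v (suc k) ≡ 0ℤ
      next≡0 = below d (suc k) (s≤s z≤n) (trans (ℕP.+-suc d k) d+k<n)

  L-zero : ∀ n → L n ℓ (replicate n 0ℤ)
  L-zero n = subst (0ℤ ≤_) (sym (entry-replicate n 1)) ≤-refl ,
             λ k _ _ → subst₂ (λ a b → a * s ℓ (suc k) ≤ b * s ℓ k)
                              (sym (entry-replicate n k)) (sym (entry-replicate n (suc k))) ≤-refl

  L-add : ∀ {n} (u v : Vec ℤ n) → L n ℓ u → L n ℓ v → L n ℓ (zipWith _+_ u v)
  L-add u v (0≤u₁ , u-ordered) (0≤v₁ , v-ordered) =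
    subst (0ℤ ≤_) (sym (entry-zipWith u v 1)) (0≤+ 0≤u₁ 0≤v₁) ,
    λ k 1≤k k<n → subst₂ (λ a b → a * s ℓ (suc k) ≤ b * s ℓ k)
                    (sym (entry-zipWith u v k)) (sym (entry-zipWith u v (suc k)))
                    (subst₂ _≤_ (sym (*-distribʳ-+ (s ℓ (suc k)) (entry u k) (entry v k)))
                                (sym (*-distribʳ-+ (s ℓ k) (entry u (suc k)) (entry v (suc k))))
                                (+-mono-≤ (u-ordered k 1≤k k<n) (v-ordered k 1≤k k<n)))

  generated-in-L : ∀ {n} {B : Vec ℤ n → Set} → B ⊆ L n ℓ → Generated B ⊆ L n ℓ
  generated-in-L B⊆L _ gen-zero                  = L-zero _
  generated-in-L B⊆L _ (gen-add {h} {μ} h∈B μ∈⟨B⟩) = L-add h μ (B⊆L h h∈B) (generated-in-L B⊆L μ μ∈⟨B⟩)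

  ordered-⊓ : ∀ {n f g} → Ordered n f → Ordered n g → Ordered n (λ k → f k ⊓ g k)
  ordered-⊓ {f = f} {g} f-ordered g-ordered k 1≤k k<n with ≤-total (f (suc k)) (g (suc k))
  ... | inj₁ f≤g rewrite i≤j⇒i⊓j≡i f≤g =
    ≤-trans (≤-scale (s-nonneg (suc k)) (i⊓j≤i (f k) (g k))) (f-ordered k 1≤k k<n)
  ... | inj₂ g≤f rewrite i≥j⇒i⊓j≡j g≤f =
    ≤-trans (≤-scale (s-nonneg (suc k)) (i⊓j≤j (f k) (g k))) (g-ordered k 1≤k k<n)

  ordered-residual : ∀ {n f g} → (∀ k → 1 ℕ.≤ k → k ℕ.< n → g k < f k → gap g k ≤ gap f k) →
                     Ordered n (λ k → f k - f k ⊓ g k)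
  ordered-residual {f = f} {g} dominates k 1≤k k<n with f k ≤? g k
  ... | yes fₖ≤gₖ rewrite i≤j⇒i⊓j≡i fₖ≤gₖ =
    ≤-by _ (cancel (f k) (f (suc k) - f (suc k) ⊓ g (suc k)) (s ℓ k) (s ℓ (suc k)))
         (0≤* (i≤j⇒0≤j-i (i⊓j≤i (f (suc k)) (g (suc k)))) (s-nonneg k))
    where
    cancel : ∀ a b S T → b * S - (a - a) * T ≡ b * S
    cancel = solve-∀
  ... | no fₖ≰gₖ rewrite i≥j⇒i⊓j≡j (<⇒≤ (≰⇒> fₖ≰gₖ)) =
    ≤-by _ (split (f (suc k)) (f k) (g (suc k)) (g k) (f (suc k) ⊓ g (suc k)) (s ℓ k) (s ℓ (suc k)))
         (0≤+ (i≤j⇒0≤j-i (dominates k 1≤k k<n (≰⇒> fₖ≰gₖ)))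
              (0≤* (i≤j⇒0≤j-i (i⊓j≤j (f (suc k)) (g (suc k)))) (s-nonneg k)))
    where
    split : ∀ f₁ f₀ g₁ g₀ m S T → (f₁ - m) * S - (f₀ - g₀) * T
                                 ≡ ((f₁ * S - f₀ * T) - (g₁ * S - g₀ * T)) + (g₁ - m) * S
    split = solve-∀

module Minimality (ℓ : ℕ) (2≤ℓ : 2 Data.Nat.≤ ℓ) where

  open import Data.Nat as ℕ using (suc; z≤n; s≤s)
  open import Data.Nat.Properties as ℕP using ()
  open import Data.Integer using (0ℤ; _+_; _-_; _*_; _≤_; _<_; _≤?_; _≟_)
  open import Data.Integer.Properties
  open import Data.Integer.Tactic.RingSolver using (solve-∀)
  open import Data.Empty using (⊥; ⊥-elim)
  open import Data.Vec using (replicate; zipWith)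
  open import Data.Vec.Properties using (zipWith-identityʳ)
  open import Data.Product using (_,_; proj₁; proj₂)
  open import Relation.Binary.PropositionalEquality using (_≡_; sym; trans; cong; cong₂; subst; subst₂)
  open import Relation.Nullary using (¬_; yes; no)
  open IntegerArithmetic
  open Growth ℓ 2≤ℓ
  open UnimodularBasis ℓ 2≤ℓ
  open Vectors
  open Cone ℓ 2≤ℓ

  summand-below : ∀ {y y′ S} → y + y′ ≡ S → 0ℤ < y′ → S ≤ y → ⊥
  summand-below {y} {y′} y+y′≡S 0<y′ S≤y =
    <⇒≱ (subst (y <_) y+y′≡S (subst (_< y + y′) (+-identityʳ y) (+-monoʳ-< y 0<y′))) S≤y

  mediant : ∀ {p q p′ q′ T U} → (p + p′) * T ≡ (q + q′) * U → ¬ (q * U ≤ p * T) → q′ * U ≤ p′ * T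
  mediant {p} {q} {p′} {q′} {T} {U} sum-on-line q·U≰p·T =
    ≤-by _ (split p q p′ q′ T U)
         (0≤+ (i≤j⇒0≤j-i (<⇒≤ (≰⇒> q·U≰p·T))) (≤-reflexive (sym (i≡j⇒i-j≡0 sum-on-line))))
    where
    split : ∀ p q p′ q′ T U → p′ * T - q′ * U ≡ (q * U - p * T) + ((p + p′) * T - (q + q′) * U)
    split = solve-∀

  -- (s_i, s_{i+1}) is not a sum of two vectors (p, q), (p′, q′) with q, q′ > 0
  -- of the plane cone p/q ≤ s_N/s_{N+1}: both would have slope ≤ s_N/s_{N+1},
  -- so i ≤ N; one of them has slope ≥ s_i/s_{i+1}, and then slope-bound
  -- makes its second entry at least s_{i+1}.
  plane-indecomposable : ∀ N i p q p′ q′ → 0ℤ < q → 0ℤ < q′ →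
                         p * s ℓ (suc N) ≤ q * s ℓ N → p′ * s ℓ (suc N) ≤ q′ * s ℓ N →
                         p + p′ ≡ s ℓ i → q + q′ ≡ s ℓ (suc i) → ⊥
  plane-indecomposable N i p q p′ q′ 0<q 0<q′ below below′ p+p′ q+q′ with i ℕ.≤? N
  ... | no  i≰N = <⇒≱ (ratio-increasing (ℕP.≰⇒> i≰N))
                      (subst₂ _≤_ (*-comm (s ℓ i) (s ℓ (suc N))) (*-comm (s ℓ (suc i)) (s ℓ N)) sum-below)
    where
    sum-below : s ℓ i * s ℓ (suc N) ≤ s ℓ (suc i) * s ℓ N
    sum-below = subst₂ (λ a b → a * s ℓ (suc N) ≤ b * s ℓ N) p+p′ q+q′
                  (subst₂ _≤_ (sym (*-distribʳ-+ (s ℓ (suc N)) p p′)) (sym (*-distribʳ-+ (s ℓ N) q q′))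
                          (+-mono-≤ below below′))
  ... | yes i≤N with q * s ℓ i ≤? p * s ℓ (suc i)
  ...   | yes above  = summand-below q+q′ 0<q′ (slope-bound i≤N p q 0<q above below)
  ...   | no  ¬above = summand-below (trans (+-comm q′ q) q+q′) 0<q
                         (slope-bound i≤N p′ q′ 0<q′ (mediant {p} {q} on-line ¬above) below′)
    where
    on-line : (p + p′) * s ℓ (suc i) ≡ (q + q′) * s ℓ i
    on-line = trans (cong₂ _*_ p+p′ (sym q+q′)) (*-comm (s ℓ i) (q + q′))

  -- If h = b + μ with h, b ∈ H and μ in the cone, then μ = 0: a nonzero μ has
  -- positive last entry, contradicting plane-indecomposable on the last two entries.
  H-indecomposable : ∀ N → 1 ℕ.≤ N → ∀ b μ → H (suc N) ℓ (zipWith _+_ b μ) → H (suc N) ℓ b →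
                     L (suc N) ℓ μ → μ ≡ replicate (suc N) 0ℤ
  H-indecomposable N 1≤N b μ (_ , i , _ , h_N≡ , hₙ≡) (b∈L , j , _ , _ , bₙ≡) μ∈L
    with entry μ (suc N) ≟ 0ℤ
  ... | yes μₙ≡0 = L-vanishing μ μ∈L μₙ≡0
  ... | no  μₙ≢0 = ⊥-elim (plane-indecomposable N i
                     (entry b N) (entry b (suc N)) (entry μ N) (entry μ (suc N)) 0<bₙ 0<μₙ
                     (proj₂ b∈L N 1≤N ℕP.≤-refl) (proj₂ μ∈L N 1≤N ℕP.≤-refl)
                     (trans (sym (entry-zipWith b μ N)) h_N≡)
                     (trans (sym (entry-zipWith b μ (suc N))) hₙ≡))
    where
    0<bₙ : 0ℤ < entry b (suc N)
    0<bₙ = subst (0ℤ <_) (sym bₙ≡) (s-pos j)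
    0<μₙ : 0ℤ < entry μ (suc N)
    0<μₙ = ≤∧≢⇒< (L-nonneg μ μ∈L (suc N) (s≤s z≤n) ℕP.≤-refl) (λ 0≡μₙ → μₙ≢0 (sym 0≡μₙ))

  -- Every generating subset B′ of H contains all of H: an element h ≠ 0 of H
  -- is generated as h = b + μ with b ∈ B′ ⊆ H and μ in the cone, so μ = 0.
  H-minimal : ∀ N → 1 ℕ.≤ N → ∀ B′ → B′ ⊆ H (suc N) ℓ → Generates (L (suc N) ℓ) B′ →
              H (suc N) ℓ ⊆ B′
  H-minimal N 1≤N B′ B′⊆H (_ , generates) h h∈H@(h∈L , i , _ , _ , hₙ≡) with generates h h∈L
  ... | gen-zero =
    ⊥-elim (<⇒≱ (s-pos i) (≤-reflexive (trans (sym hₙ≡) (entry-replicate (suc N) (suc N)))))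
  ... | gen-add {b} {μ} b∈B′ μ∈⟨B′⟩ = subst B′ b≡b+μ b∈B′
    where
    μ≡0 : μ ≡ replicate (suc N) 0ℤ
    μ≡0 = H-indecomposable N 1≤N b μ h∈H (B′⊆H b b∈B′)
            (generated-in-L (λ v v∈B′ → proj₁ (B′⊆H v v∈B′)) μ μ∈⟨B′⟩)
    b≡b+μ : b ≡ zipWith _+_ b μ
    b≡b+μ = trans (sym (zipWith-identityʳ +-identityʳ b)) (cong (zipWith _+_ b) (sym μ≡0))

-- A nonzero point λ (n = N + 1) is peeled as λ = h + r with
--   h_k = min(λ_k, s_{k-c}),   r = λ - h,
-- where the shift c is chosen so that (s_{N-c}, s_{N-c+1}) fits below
-- (λ_N, λ_n) while (s_{N-c+1}, s_{N-c+2}) does not.  Then h ∈ H, and the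
-- choice of c is exactly what keeps r in the cone; r_n < λ_n gives termination.
module Generation (ℓ : ℕ) (2≤ℓ : 2 Data.Nat.≤ ℓ) where

  open import Data.Nat as ℕ using (zero; suc; z≤n; s≤s)
  open import Data.Nat.Properties as ℕP using ()
  open import Data.Integer using (ℤ; +_; 0ℤ; 1ℤ; _+_; _-_; _*_; _⊓_; _≤_; _<_; _≤?_; ∣_∣)
  open import Data.Integer.Properties
  open import Data.Integer.Tactic.RingSolver using (solve-∀)
  open import Data.Empty using (⊥-elim)
  open import Data.Product using (Σ; _×_; _,_)
  open import Data.Vec using (Vec; zipWith)
  open import Relation.Binary.PropositionalEquality
    using (_≡_; refl; sym; trans; cong; cong₂; subst; module ≡-Reasoning)
  open import Relation.Nullary using (¬_; yes; no)
  open import Relation.Nullary.Decidable using (_×-dec_)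
  open import Relation.Unary using (Decidable)
  open IntegerArithmetic
  open Identities ℓ
  open Growth ℓ 2≤ℓ
  open UnimodularBasis ℓ 2≤ℓ
  open Vectors
  open Cone ℓ 2≤ℓ

  -- The point (0, ..., 0, s_1, s_2, ...) of the cone: its k-th entry is s_{k-c}.
  profile : ℕ → ℕ → ℤ
  profile c k = s ℓ (k ℕ.∸ c)

  profile-gap : ∀ c k → c ℕ.≤ k → gap (profile c) k ≡ s ℓ c
  profile-gap c k c≤k = subst (λ j → gap (profile c) j ≡ s ℓ c) (ℕP.m∸n+n≡m c≤k) (shifted (k ℕ.∸ c))
    where
    shifted : ∀ a → gap (profile c) (a ℕ.+ c) ≡ s ℓ c
    shifted a rewrite ℕP.m+n∸n≡m a c | ℕP.m+n∸n≡m (suc a) c = casoratian a c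

  profile-gap-below : ∀ c k → k ℕ.< c → gap (profile c) k ≡ 0ℤ
  profile-gap-below c k k<c rewrite ℕP.m≤n⇒m∸n≡0 k<c | ℕP.m≤n⇒m∸n≡0 (ℕP.<⇒≤ k<c) = refl

  profile-gap-nonneg : ∀ c k → 0ℤ ≤ gap (profile c) k
  profile-gap-nonneg c k with c ℕ.≤? k
  ... | yes c≤k = subst (0ℤ ≤_) (sym (profile-gap c k c≤k)) (s-nonneg c)
  ... | no  c≰k = subst (0ℤ ≤_) (sym (profile-gap-below c k (ℕP.≰⇒> c≰k))) ≤-refl

  profile-ordered : ∀ n c → Ordered n (profile c)
  profile-ordered n c k _ _ = 0≤i-j⇒j≤i (profile-gap-nonneg c k)

  -- Along a point f of the cone, s_t ≤ f_j propagates to s_{t+1} ≤ f_{j+1}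
  -- (for 1 ≤ t ≤ j), since s_{t+1} s_j - s_t s_{j+1} = s_{j-t} < s_j.
  propagate-step : ∀ {n f t j} → Ordered n f → 1 ℕ.≤ t → t ℕ.≤ j → j ℕ.< n →
                   s ℓ t ≤ f j → s ℓ (suc t) ≤ f (suc j)
  propagate-step {n} {f} {t} {j} ordered 1≤t t≤j j<n sₜ≤fⱼ =
    0≤i-j⇒j≤i (subst (0ℤ ≤_) (shift (f (suc j)) (s ℓ (suc t)))
                     (<⇒0≤ (positive-factor {t = f (suc j) - s ℓ (suc t) + 1ℤ}
                                             (s-nonneg j) 0<excess·sⱼ)))
    where
    casoratian′ : s ℓ (suc t) * s ℓ j - s ℓ t * s ℓ (suc j) ≡ s ℓ (j ℕ.∸ t)
    casoratian′ = subst (λ i → s ℓ (suc t) * s ℓ i - s ℓ t * s ℓ (suc i) ≡ s ℓ (j ℕ.∸ t))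
                        (ℕP.m+[n∸m]≡n t≤j) (casoratian t (j ℕ.∸ t))
    regroup : ∀ f₁ f₀ σ₀ σ₁ σ₀′ σ₁′ c → σ₁ * σ₀′ - σ₀ * σ₁′ ≡ c →
              (f₁ - σ₁ + 1ℤ) * σ₀′ - 0ℤ - 1ℤ
                ≡ (f₁ * σ₀′ - f₀ * σ₁′) + (f₀ - σ₀) * σ₁′ + (σ₀′ - c - 1ℤ)
    regroup f₁ f₀ σ₀ σ₁ σ₀′ σ₁′ _ refl = ring f₁ f₀ σ₀ σ₁ σ₀′ σ₁′
      where
      ring : ∀ f₁ f₀ σ₀ σ₁ σ₀′ σ₁′ → (f₁ - σ₁ + 1ℤ) * σ₀′ - 0ℤ - 1ℤ
               ≡ (f₁ * σ₀′ - f₀ * σ₁′) + (f₀ - σ₀) * σ₁′ + (σ₀′ - (σ₁ * σ₀′ - σ₀ * σ₁′) - 1ℤ)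
      ring = solve-∀
    -- (f_{j+1} - s_{t+1} + 1) s_j > 0, because
    -- f_{j+1} s_j ≥ f_j s_{j+1} ≥ s_t s_{j+1} = s_{t+1} s_j - s_{j-t} > (s_{t+1} - 1) s_j.
    0<excess·sⱼ : 0ℤ < (f (suc j) - s ℓ (suc t) + 1ℤ) * s ℓ j
    0<excess·sⱼ =
      <-by _ (regroup (f (suc j)) (f j) (s ℓ t) (s ℓ (suc t)) (s ℓ j) (s ℓ (suc j)) _ casoratian′)
        (0≤+ (0≤+ (i≤j⇒0≤j-i (ordered j (ℕP.≤-trans 1≤t t≤j) j<n))
                  (0≤* (i≤j⇒0≤j-i sₜ≤fⱼ) (s-nonneg (suc j))))
             (<⇒0≤ (s-mono-< (ℕP.∸-monoʳ-< {m = j} {o = 0} 1≤t t≤j))))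
    shift : ∀ a b → a - b + 1ℤ - 0ℤ - 1ℤ ≡ a - b
    shift = solve-∀

  propagate-profile : ∀ {n f e k} → Ordered n f → e ℕ.< k → profile e k ≤ f k →
                      ∀ j → k ℕ.≤ j → j ℕ.≤ n → profile e j ≤ f j
  propagate-profile {n} {f} {e} {k} ordered e<k base j k≤j j≤n =
    subst (λ i → profile e i ≤ f i) (ℕP.m∸n+n≡m k≤j)
          (along (j ℕ.∸ k) (subst (ℕ._≤ n) (sym (ℕP.m∸n+n≡m k≤j)) j≤n))
    where
    along : ∀ d → d ℕ.+ k ℕ.≤ n → profile e (d ℕ.+ k) ≤ f (d ℕ.+ k)
    along zero    _     = base
    along (suc d) bound =
      subst (λ i → s ℓ i ≤ f (suc (d ℕ.+ k))) (sym (ℕP.+-∸-assoc 1 (ℕP.<⇒≤ e<d+k)))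
            (propagate-step {f = f} ordered (ℕP.m<n⇒0<n∸m e<d+k) (ℕP.m∸n≤m (d ℕ.+ k) e) bound
                            (along d (ℕP.<⇒≤ bound)))
      where
      e<d+k : e ℕ.< d ℕ.+ k
      e<d+k = ℕP.<-≤-trans e<k (ℕP.m≤n+m k d)

  Fits : ℕ → (ℕ → ℤ) → ℕ → Set
  Fits N f c = profile c (suc N) ≤ f (suc N) × profile c N ≤ f N

  fits? : ∀ N f → Decidable (Fits N f)
  fits? N f c = (profile c (suc N) ≤? f (suc N)) ×-dec (profile c N ≤? f N)

  descend : ∀ {P : ℕ → Set} → Decidable P → ∀ c → P c →
            Σ ℕ λ c′ → c′ ℕ.≤ c × P c′ × (∀ e → c′ ≡ suc e → ¬ P e)
  descend P? zero    P0 = zero , z≤n , P0 , λ _ ()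
  descend P? (suc e) Pc with P? e
  ... | no  ¬Pe = suc e , ℕP.≤-refl , Pc , λ { _ refl → ¬Pe }
  ... | yes Pe with descend P? e Pe
  ...   | c′ , c′≤e , Pc′ , lowest = c′ , ℕP.m≤n⇒m≤1+n c′≤e , Pc′ , lowest

  -- If the profile with shift c fits and the one with
  -- shift c - 1 does not, then wherever f exceeds the profile, f's gap is at
  -- least the profile's gap s_c: a smaller gap would, by escape-at, lift f_k to
  -- s_{k-c+1}, and propagate-profile would then make shift c - 1 fit.
  gap-dominates : ∀ N f c → Ordered (suc N) f → (∀ e → c ≡ suc e → ¬ Fits N f e) →
                  ∀ k → 1 ℕ.≤ k → k ℕ.< suc N → profile c k < f k → gap (profile c) k ≤ gap f k
  gap-dominates N f c ordered lowest k 1≤k k<n _ with c ℕ.≤? k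
  ... | no c≰k = subst (_≤ gap f k) (sym (profile-gap-below c k (ℕP.≰⇒> c≰k)))
                       (i≤j⇒0≤j-i (ordered k 1≤k k<n))
  gap-dominates N f zero    ordered lowest k 1≤k k<n _ | yes c≤k =
    subst (_≤ gap f k) (sym (profile-gap zero k c≤k)) (i≤j⇒0≤j-i (ordered k 1≤k k<n))
  gap-dominates N f (suc e) ordered lowest k 1≤k k<n fₖ>profile | yes c≤k with s ℓ (suc e) ≤? gap f k
  ... | yes large = subst (_≤ gap f k) (sym (profile-gap (suc e) k c≤k)) large
  ... | no  small = ⊥-elim (lowest e refl
        ( propagate-profile {f = f} ordered c≤k lifted (suc N) (ℕP.<⇒≤ k<n) ℕP.≤-refl
        , propagate-profile {f = f} ordered c≤k lifted N (ℕP.≤-pred k<n) (ℕP.n≤1+n N)))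
    where
    lifted : profile e k ≤ f k
    lifted = escape-at e k (f k) (f (suc k)) c≤k fₖ>profile (i≤j⇒0≤j-i (ordered k 1≤k k<n)) (≰⇒> small)

  choose-shift : ∀ N f → 0ℤ < f (suc N) → 0ℤ ≤ f N →
                 Σ ℕ λ c → c ℕ.≤ N × Fits N f c × (∀ e → c ≡ suc e → ¬ Fits N f e)
  choose-shift N f 0<fₙ 0≤f_N = descend (fits? N f) N
    ( subst (λ i → s ℓ i ≤ f (suc N)) (sym (ℕP.m+n∸n≡m 1 N)) (i<j⇒suc[i]≤j 0<fₙ)
    , subst (λ i → s ℓ i ≤ f N) (sym (ℕP.n∸n≡0 N)) 0≤f_N)

  peel-at-shift : ∀ N → 1 ℕ.≤ N → ∀ v → L (suc N) ℓ v → ∀ c → c ℕ.≤ N → Fits N (entry v) c →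
                  (∀ e → c ≡ suc e → ¬ Fits N (entry v) e) →
                  Σ (Vec ℤ (suc N)) λ h → Σ (Vec ℤ (suc N)) λ r →
                    H (suc N) ℓ h × L (suc N) ℓ r × v ≡ zipWith _+_ h r ×
                    entry r (suc N) < entry v (suc N)
  peel-at-shift N 1≤N v (0≤v₁ , ordered) c c≤N (fitsₙ , fits_N) lowest =
    h , r , h∈H , r∈L , v≡h+r , rₙ<vₙ
    where
    f g : ℕ → ℤ
    f = entry v
    g = profile c
    1≤n : 1 ℕ.≤ suc N
    1≤n = s≤s z≤n
    h r : Vec ℤ (suc N)
    h = tabulate₁ (λ k → f k ⊓ g k) (suc N)
    r = tabulate₁ (λ k → f k - f k ⊓ g k) (suc N)
    entry-h : ∀ k → 1 ℕ.≤ k → k ℕ.≤ suc N → entry h k ≡ f k ⊓ g k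
    entry-h = entry-tabulate₁ (λ k → f k ⊓ g k) (suc N)
    entry-r : ∀ k → 1 ℕ.≤ k → k ℕ.≤ suc N → entry r k ≡ f k - f k ⊓ g k
    entry-r = entry-tabulate₁ (λ k → f k - f k ⊓ g k) (suc N)
    top-index : suc N ℕ.∸ c ≡ suc (N ℕ.∸ c)
    top-index = ℕP.+-∸-assoc 1 c≤N
    h∈H : H (suc N) ℓ h
    h∈H = L-tabulate₁ (λ k → f k ⊓ g k) 1≤n (⊓-glb 0≤v₁ (s-nonneg (1 ℕ.∸ c)))
                      (ordered-⊓ {f = f} {g} ordered (profile-ordered (suc N) c))
        , N ℕ.∸ c , ℕP.≤-trans (ℕP.m∸n≤m N c) (ℕP.n≤1+n N)
        , trans (entry-h N 1≤N (ℕP.n≤1+n N)) (i≥j⇒i⊓j≡j fits_N)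
        , trans (entry-h (suc N) 1≤n ℕP.≤-refl) (trans (i≥j⇒i⊓j≡j fitsₙ) (cong (s ℓ) top-index))
    r∈L : L (suc N) ℓ r
    r∈L = L-tabulate₁ (λ k → f k - f k ⊓ g k) 1≤n (i≤j⇒0≤j-i (i⊓j≤i (f 1) (g 1)))
                      (ordered-residual {f = f} {g} (gap-dominates N f c ordered lowest))
    v≡h+r : v ≡ zipWith _+_ h r
    v≡h+r = entries-determine v (zipWith _+_ h r) λ k 1≤k k≤n → sym (begin
      entry (zipWith _+_ h r) k        ≡⟨ entry-zipWith h r k ⟩
      entry h k + entry r k            ≡⟨ cong₂ _+_ (entry-h k 1≤k k≤n) (entry-r k 1≤k k≤n) ⟩
      f k ⊓ g k + (f k - f k ⊓ g k)    ≡⟨ cancel (f k ⊓ g k) (f k) ⟩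
      f k                              ∎)
      where
      open ≡-Reasoning
      cancel : ∀ m a → m + (a - m) ≡ a
      cancel = solve-∀
    rₙ<vₙ : entry r (suc N) < f (suc N)
    rₙ<vₙ = subst (_< f (suc N)) (sym (trans (entry-r (suc N) 1≤n ℕP.≤-refl)
                                               (cong (f (suc N) -_) (i≥j⇒i⊓j≡j fitsₙ))))
                  (<-by _ (shrink (f (suc N)) (g (suc N))) (<⇒0≤ 0<gₙ))
      where
      0<gₙ : 0ℤ < g (suc N)
      0<gₙ = subst (λ i → 0ℤ < s ℓ i) (sym top-index) (s-pos (N ℕ.∸ c))
      shrink : ∀ a b → a - (a - b) - 1ℤ ≡ b - 0ℤ - 1ℤ
      shrink = solve-∀

  generated-below : ∀ N → 1 ℕ.≤ N → ∀ F v → L (suc N) ℓ v → entry v (suc N) ≤ + F →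
                    Generated (H (suc N) ℓ) v
  generated-below N 1≤N F v v∈L vₙ≤F with entry v (suc N) ≤? 0ℤ
  ... | yes vₙ≤0 = subst (Generated (H (suc N) ℓ)) (sym (L-vanishing v v∈L vₙ≡0)) gen-zero
    where
    vₙ≡0 : entry v (suc N) ≡ 0ℤ
    vₙ≡0 = ≤-antisym vₙ≤0 (L-nonneg v v∈L (suc N) (s≤s z≤n) ℕP.≤-refl)
  generated-below N 1≤N zero    v v∈L vₙ≤F | no vₙ≰0 = ⊥-elim (vₙ≰0 vₙ≤F)
  generated-below N 1≤N (suc F) v v∈L vₙ≤F | no vₙ≰0
    with choose-shift N (entry v) (≰⇒> vₙ≰0) (L-nonneg v v∈L N 1≤N (ℕP.n≤1+n N))
  ... | c , c≤N , fits , lowest with peel-at-shift N 1≤N v v∈L c c≤N fits lowest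
  ...   | h , r , h∈H , r∈L , v≡h+r , rₙ<vₙ =
    subst (Generated (H (suc N) ℓ)) (sym v≡h+r)
          (gen-add h∈H (generated-below N 1≤N F r r∈L (i<j⇒i≤pred[j] (<-≤-trans rₙ<vₙ vₙ≤F))))

  H-generates : ∀ N → 1 ℕ.≤ N → L (suc N) ℓ ⊆ Generated (H (suc N) ℓ)
  H-generates N 1≤N v v∈L =
    generated-below N 1≤N ∣ entry v (suc N) ∣ v v∈L
      (≤-reflexive (sym (0≤i⇒+∣i∣≡i (L-nonneg v v∈L (suc N) (s≤s z≤n) ℕP.≤-refl))))

open import Data.Nat using (suc; _≤_; z≤n; s≤s)
open import Data.Product using (_,_; proj₁)

theorem4p1 : (ℓ n : ℕ) → 2 ≤ ℓ → 2 ≤ n → IsHilbertBasis (L n ℓ) (H n ℓ)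
theorem4p1 ℓ (suc (suc N)) 2≤ℓ (s≤s (s≤s z≤n)) =
  ((λ _ → proj₁) , H-generates (suc N) (s≤s z≤n)) , H-minimal (suc N) (s≤s z≤n)
  where
  open Generation ℓ 2≤ℓ using (H-generates)
  open Minimality ℓ 2≤ℓ using (H-minimal)
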